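{- For all integers $\ell\ge0$ and $k\ge\ell+2$, we have $a_{k,k+\ell}=2F_{k+\ell}$.
   Context: $\mathbb{N}=\{1,2,3,\dots\}$, and $\mathcal{N}$ denotes the collection of finite subsets of $\mathbb{N}$. For $E\in\mathcal{N}$ and $k\in\mathbb{N}$, let $\omega_k(E)=\sum_{i\in E,\, i\neq k}1$. For $k,n\in\mathbb{N}$, let $\mathcal{A}_{k,n}=\{E\in\mathcal{N} : E=\emptyset \text{ or } \omega_k(E)<\min E\le \max E\le n\}$ and $a_{k,n}=|\mathcal{A}_{k,n}|$. $(F_n)_{n\ge0}$ is the Fibonacci sequence: $F_0=0$, $F_1=1$, $F_n=F_{n-1}+F_{n-2}$ for $n\ge2$. -}

module Defs where

open import Data.Nat using (ℕ; zero; suc; _+_; _<_; _≤_; _<?_; _≤?_)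
open import Data.Nat.Properties using (_≟_)
open import Data.Bool using (Bool; true; false)
open import Data.Fin using (Fin; toℕ)
open import Data.Vec using (Vec; []; _∷_; lookup)
open import Data.List using (List; []; _∷_; map; _++_; length; filter; foldr)
open import Data.List.Relation.Unary.All using (All)
open import Data.List.Relation.Unary.All as All using (all?)
open import Data.Sum using (_⊎_)
open import Relation.Nullary using (Dec; ¬_; yes; no)
open import Relation.Nullary.Decidable using (_⊎-dec_; ¬?)
open import Relation.Binary.PropositionalEquality using (_≡_)

F : ℕ → ℕ
F zero = zero
F (suc zero) = suc zero
F (suc (suc n)) = F (suc n) + F n

-- A finite set E ⊆ {1,…,n} is encoded by its characteristic vector
-- v : Vec Bool n, where position i (i = 0,…,n-1) says whether i+1 ∈ E.
-- This is a bijection with { E ∈ 𝒩 : E ⊆ {1,…,n} }.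
FinSet : ℕ → Set
FinSet n = Vec Bool n

elemsFrom : ∀ {n} → ℕ → Vec Bool n → List ℕ
elemsFrom s [] = []
elemsFrom s (true ∷ v) = s ∷ elemsFrom (suc s) v
elemsFrom s (false ∷ v) = elemsFrom (suc s) v

elems : ∀ {n} → FinSet n → List ℕ
elems = elemsFrom 1

allFinSets : (n : ℕ) → List (FinSet n)
allFinSets zero = [] ∷ []
allFinSets (suc n) = map (true ∷_) (allFinSets n) ++ map (false ∷_) (allFinSets n)

ω : ℕ → List ℕ → ℕ
ω k E = length (filter (λ i → ¬? (i ≟ k)) E)

-- "ω_k(E) < min E" for nonempty E: ω_k(E) < i for every i ∈ E
-- (equivalent to being below the minimum).
-- E ∈ 𝒜_{k,n}  (for E ⊆ {1,…,n}, so max E ≤ n holds automatically):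
-- E = ∅ or ω_k(E) < min E.
InA : ℕ → List ℕ → Set
InA k E = E ≡ [] ⊎ All (λ i → ω k E < i) E

isEmpty? : (E : List ℕ) → Dec (E ≡ [])
isEmpty? [] = yes Relation.Binary.PropositionalEquality.refl
isEmpty? (x ∷ E) = no (λ ())

InA? : (k : ℕ) → (E : List ℕ) → Dec (InA k E)
InA? k E = isEmpty? E ⊎-dec all? (λ i → ω k E <? i) E

a : ℕ → ℕ → ℕ
a k n = length (filter (λ v → InA? k (elems v)) (allFinSets n))

-- Scan a set E ⊆ {1,…,n} from its minimum m: E is admissible iff the rest R of E satisfies
-- ω_k(m ∷ R) < m, a bound on the size of R ∖ {k}. Membership of k never changes that size, so
-- once the scanned range contains k it is a free bit and the count doubles; the sets with
-- minimum ≥ k are all admissible because at most ℓ < k elements follow k. What remains is the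
-- number of E ⊆ {1,…,k+ℓ-1} with E = ∅ or |E| < min E, and these numbers obey the Fibonacci
-- recurrence, giving a_{k,k+ℓ} = 2 F_{k+ℓ}.
module Submission where

open import Defs
open import Data.Nat using (ℕ; zero; suc; pred; _+_; _*_; _^_; _≤_; _<_; _<?_; s≤s; z<s; s<s; s<s⁻¹)
open import Data.Nat.Properties
  using (_≟_; +-identityʳ; +-suc; +-comm; *-distribˡ-+; m≤m+n; m<m+n; <-trans; <-≤-trans;
         m<n⇒m<1+n; m≤n⇒m≤1+n; <⇒≤; m<1+n⇒m≤n; ≤-refl; ≤-reflexive; >⇒≢; m≢1+n+m)
open import Data.Nat.Tactic.RingSolver using (solve-∀)
open import Data.Bool using (Bool; true; false)
open import Data.Vec using (Vec; []; _∷_)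
open import Data.List using (List; []; _∷_; map; _++_; length; filter)
open import Data.List.Properties using (length-++; filter-++; filter-≐; filter-accept; filter-reject)
open import Data.List.Relation.Unary.All using (All; []; _∷_)
import Data.List.Relation.Unary.All as All
open import Data.Product using (_,_)
open import Data.Sum using (inj₁; inj₂)
open import Function using (_∘_)
open import Function.Bundles using (_⇔_; mk⇔; Equivalence)
open import Function.Construct.Composition using (_⇔-∘_)
open import Level using (0ℓ)
open import Relation.Nullary using (does)
open import Relation.Nullary.Decidable using (¬?)
open import Relation.Unary using (Pred; Decidable)
open import Relation.Binary.PropositionalEquality

count : ∀ n {P : Pred (Vec Bool n) 0ℓ} → Decidable P → ℕ
count n P? = length (filter P? (allFinSets n))

length-filter-map : ∀ {A B : Set} {P : Pred B 0ℓ} (P? : Decidable P) (g : A → B) (xs : List A) →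
                    length (filter P? (map g xs)) ≡ length (filter (P? ∘ g) xs)
length-filter-map P? g [] = refl
length-filter-map P? g (x ∷ xs) with does (P? (g x))
... | true  = cong suc (length-filter-map P? g xs)
... | false = length-filter-map P? g xs

count-suc : ∀ n {P} (P? : Decidable P) →
            count (suc n) P? ≡ count n (P? ∘ (true ∷_)) + count n (P? ∘ (false ∷_))
count-suc n P? = begin
    length (filter P? (map (true ∷_) vs ++ map (false ∷_) vs))
  ≡⟨ cong length (filter-++ P? (map (true ∷_) vs) _) ⟩
    length (filter P? (map (true ∷_) vs) ++ filter P? (map (false ∷_) vs))
  ≡⟨ length-++ (filter P? (map (true ∷_) vs)) ⟩
    length (filter P? (map (true ∷_) vs)) + length (filter P? (map (false ∷_) vs))
  ≡⟨ cong₂ _+_ (length-filter-map P? (true ∷_) vs) (length-filter-map P? (false ∷_) vs) ⟩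
    count n (P? ∘ (true ∷_)) + count n (P? ∘ (false ∷_))
  ∎
  where
    open ≡-Reasoning
    vs = allFinSets n

count-cong : ∀ n {P Q} (P? : Decidable P) (Q? : Decidable Q) →
             (∀ v → P v ⇔ Q v) → count n P? ≡ count n Q?
count-cong n P? Q? P⇔Q =
  cong length (filter-≐ P? Q? ((λ {v} → Equivalence.to (P⇔Q v)) , (λ {v} → Equivalence.from (P⇔Q v)))
                        (allFinSets n))

-- Subsets of {s, …, s + r - 1} whose increasing list of elements satisfies P.
#sets : (s r : ℕ) {P : Pred (List ℕ) 0ℓ} → Decidable P → ℕ
#sets s r P? = count r (P? ∘ elemsFrom s)

#sets-suc : ∀ s r {P} (P? : Decidable P) →
            #sets s (suc r) P? ≡ #sets (suc s) r (P? ∘ (s ∷_)) + #sets (suc s) r P?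
#sets-suc s r P? = count-suc r (P? ∘ elemsFrom s)

elemsFrom-≥ : ∀ {n} s (v : Vec Bool n) → All (s ≤_) (elemsFrom s v)
elemsFrom-≥ s []          = []
elemsFrom-≥ s (true ∷ v)  = ≤-refl ∷ All.map <⇒≤ (elemsFrom-≥ (suc s) v)
elemsFrom-≥ s (false ∷ v) = All.map <⇒≤ (elemsFrom-≥ (suc s) v)

#sets-cong : ∀ s r {P Q} (P? : Decidable P) (Q? : Decidable Q) →
             (∀ {E} → All (s ≤_) E → P E ⇔ Q E) → #sets s r P? ≡ #sets s r Q?
#sets-cong s r P? Q? P⇔Q = count-cong r (P? ∘ elemsFrom s) (Q? ∘ elemsFrom s) (λ v → P⇔Q (elemsFrom-≥ s v))

-- Number of subsets of an r-element set with fewer than b elements.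
smallSubsets : ℕ → ℕ → ℕ
smallSubsets zero    zero    = 0
smallSubsets zero    (suc b) = 1
smallSubsets (suc r) b       = smallSubsets r (pred b) + smallSubsets r b

-- Number of E ⊆ {c + 1, …, c + r} with E = ∅ or |E| < min E.
schreier : ℕ → ℕ → ℕ
schreier zero    c = 1
schreier (suc r) c = smallSubsets r c + schreier r (suc c)

smallSubsets-zero : ∀ r → smallSubsets r 0 ≡ 0
smallSubsets-zero zero    = refl
smallSubsets-zero (suc r) = cong₂ _+_ (smallSubsets-zero r) (smallSubsets-zero r)

suc<⇔<pred : ∀ m n → suc m < n ⇔ m < pred n
suc<⇔<pred m zero    = mk⇔ (λ ()) (λ ())
suc<⇔<pred m (suc n) = mk⇔ s<s⁻¹ s<s

m+m≡2*m : ∀ m → m + m ≡ 2 * m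
m+m≡2*m m = cong (m +_) (sym (+-identityʳ m))

smallSubsets-all : ∀ r b → r < b → smallSubsets r b ≡ 2 ^ r
smallSubsets-all zero    (suc b) _         = refl
smallSubsets-all (suc r) (suc b) (s<s r<b) = begin
  smallSubsets r b + smallSubsets r (suc b) ≡⟨ cong₂ _+_ (smallSubsets-all r b r<b)
                                                          (smallSubsets-all r (suc b) (m<n⇒m<1+n r<b)) ⟩
  2 ^ r + 2 ^ r                             ≡⟨ m+m≡2*m (2 ^ r) ⟩
  2 ^ suc r                                 ∎
  where open ≡-Reasoning

schreier-all : ∀ r c → r ≤ c → schreier r c ≡ 2 ^ r
schreier-all zero    c _   = refl
schreier-all (suc r) c r<c = begin
  smallSubsets r c + schreier r (suc c) ≡⟨ cong₂ _+_ (smallSubsets-all r c r<c)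
                                                      (schreier-all r (suc c) (m≤n⇒m≤1+n (<⇒≤ r<c))) ⟩
  2 ^ r + 2 ^ r                         ≡⟨ m+m≡2*m (2 ^ r) ⟩
  2 ^ suc r                             ∎
  where open ≡-Reasoning

schreier-suc-suc : ∀ r c → schreier (suc r) (suc c) ≡ schreier r (suc c) + schreier r c
schreier-suc-suc zero    c = refl
schreier-suc-suc (suc r) c = begin
  (smallSubsets r c + smallSubsets r (suc c)) + schreier (suc r) (2 + c)
    ≡⟨ cong (smallSubsets r c + smallSubsets r (suc c) +_) (schreier-suc-suc r (suc c)) ⟩
  (smallSubsets r c + smallSubsets r (suc c)) + (schreier r (2 + c) + schreier r (suc c))
    ≡⟨ rearrange (smallSubsets r c) (smallSubsets r (suc c)) (schreier r (2 + c)) (schreier r (suc c)) ⟩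
  (smallSubsets r (suc c) + schreier r (2 + c)) + (smallSubsets r c + schreier r (suc c))
    ∎
  where
    open ≡-Reasoning
    rearrange : ∀ w x y z → (w + x) + (y + z) ≡ (x + y) + (w + z)
    rearrange = solve-∀

schreier-suc-zero : ∀ r → schreier (suc r) 0 ≡ schreier r 1
schreier-suc-zero r = cong (_+ schreier r 1) (smallSubsets-zero r)

schreier-fib : ∀ r → schreier r 0 ≡ F (suc r)
schreier-fib zero          = refl
schreier-fib (suc zero)    = refl
schreier-fib (suc (suc r)) = begin
  schreier (2 + r) 0                ≡⟨ schreier-suc-zero (suc r) ⟩
  schreier (suc r) 1                ≡⟨ schreier-suc-suc r 0 ⟩
  schreier r 1 + schreier r 0       ≡⟨ cong (_+ schreier r 0) (schreier-suc-zero r) ⟨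
  schreier (suc r) 0 + schreier r 0 ≡⟨ cong₂ _+_ (schreier-fib (suc r)) (schreier-fib r) ⟩
  F (2 + r) + F (suc r)             ∎
  where open ≡-Reasoning

module _ (k : ℕ) where

  #ω< : (s r b : ℕ) → ℕ
  #ω< s r b = #sets s r (λ E → ω k E <? b)

  #𝒜 : (s r : ℕ) → ℕ
  #𝒜 s r = #sets s r (InA? k)

  ω-cons-≡ : ∀ {s} E → s ≡ k → ω k (s ∷ E) ≡ ω k E
  ω-cons-≡ E s≡k = cong length (filter-reject (λ i → ¬? (i ≟ k)) (λ s≢k → s≢k s≡k))

  ω-cons-≢ : ∀ {s} E → s ≢ k → ω k (s ∷ E) ≡ suc (ω k E)
  ω-cons-≢ E s≢k = cong length (filter-accept (λ i → ¬? (i ≟ k)) s≢k)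

  ω<-cons-≡ : ∀ {s} E b → s ≡ k → ω k (s ∷ E) < b ⇔ ω k E < b
  ω<-cons-≡ E b s≡k = mk⇔ (subst (_< b) eq) (subst (_< b) (sym eq))
    where eq = ω-cons-≡ E s≡k

  ω<-cons-≢ : ∀ {s} E b → s ≢ k → ω k (s ∷ E) < b ⇔ ω k E < pred b
  ω<-cons-≢ E b s≢k rewrite ω-cons-≢ E s≢k = suc<⇔<pred (ω k E) b

  InA-cons⇔ : ∀ {s E} → All (s <_) E → InA k (s ∷ E) ⇔ ω k (s ∷ E) < s
  InA-cons⇔ s<E = mk⇔ (λ { (inj₁ ()) ; (inj₂ (ω<s ∷ _)) → ω<s })
                      (λ ω<s → inj₂ (ω<s ∷ All.map (<-trans ω<s) s<E))

  #ω<-suc-≡ : ∀ s r b → s ≡ k → #ω< s (suc r) b ≡ #ω< (suc s) r b + #ω< (suc s) r b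
  #ω<-suc-≡ s r b s≡k = trans (#sets-suc s r (λ E → ω k E <? b)) (cong (_+ #ω< (suc s) r b)
    (#sets-cong (suc s) r (λ E → ω k (s ∷ E) <? b) (λ E → ω k E <? b) (λ {E} _ → ω<-cons-≡ E b s≡k)))

  #ω<-suc-≢ : ∀ s r b → s ≢ k → #ω< s (suc r) b ≡ #ω< (suc s) r (pred b) + #ω< (suc s) r b
  #ω<-suc-≢ s r b s≢k = trans (#sets-suc s r (λ E → ω k E <? b)) (cong (_+ #ω< (suc s) r b)
    (#sets-cong (suc s) r (λ E → ω k (s ∷ E) <? b) (λ E → ω k E <? pred b) (λ {E} _ → ω<-cons-≢ E b s≢k)))

  #𝒜-suc-≡ : ∀ s r → s ≡ k → #𝒜 s (suc r) ≡ #ω< (suc s) r s + #𝒜 (suc s) r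
  #𝒜-suc-≡ s r s≡k = trans (#sets-suc s r (InA? k)) (cong (_+ #𝒜 (suc s) r)
    (#sets-cong (suc s) r (InA? k ∘ (s ∷_)) (λ E → ω k E <? s)
                (λ {E} s<E → ω<-cons-≡ E s s≡k ⇔-∘ InA-cons⇔ s<E)))

  #𝒜-suc-≢ : ∀ s r → s ≢ k → #𝒜 s (suc r) ≡ #ω< (suc s) r (pred s) + #𝒜 (suc s) r
  #𝒜-suc-≢ s r s≢k = trans (#sets-suc s r (InA? k)) (cong (_+ #𝒜 (suc s) r)
    (#sets-cong (suc s) r (InA? k ∘ (s ∷_)) (λ E → ω k E <? pred s)
                (λ {E} s<E → ω<-cons-≢ E s s≢k ⇔-∘ InA-cons⇔ s<E)))

  #ω<-above : ∀ s r b → k < s → #ω< s r b ≡ smallSubsets r b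
  #ω<-above s zero    zero    _   = refl
  #ω<-above s zero    (suc b) _   = refl
  #ω<-above s (suc r) b       k<s = begin
    #ω< s (suc r) b                            ≡⟨ #ω<-suc-≢ s r b (>⇒≢ k<s) ⟩
    #ω< (suc s) r (pred b) + #ω< (suc s) r b   ≡⟨ cong₂ _+_ (#ω<-above (suc s) r (pred b) k<1+s)
                                                              (#ω<-above (suc s) r b k<1+s) ⟩
    smallSubsets r (pred b) + smallSubsets r b ∎
    where
      open ≡-Reasoning
      k<1+s = m<n⇒m<1+n k<s

  #ω<-through : ∀ d s r b → d + s ≡ k → d ≤ r → #ω< s (suc r) b ≡ 2 * smallSubsets r b
  #ω<-through zero s r b s≡k _ = begin
    #ω< s (suc r) b                     ≡⟨ #ω<-suc-≡ s r b s≡k ⟩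
    #ω< (suc s) r b + #ω< (suc s) r b   ≡⟨ cong (λ n → n + n) (#ω<-above (suc s) r b (s≤s (≤-reflexive (sym s≡k)))) ⟩
    smallSubsets r b + smallSubsets r b ≡⟨ m+m≡2*m (smallSubsets r b) ⟩
    2 * smallSubsets r b                ∎
    where open ≡-Reasoning
  #ω<-through (suc d) s (suc r) b d+1+s≡k (s≤s d≤r) = begin
    #ω< s (suc (suc r)) b
      ≡⟨ #ω<-suc-≢ s (suc r) b s≢k ⟩
    #ω< (suc s) (suc r) (pred b) + #ω< (suc s) (suc r) b
      ≡⟨ cong₂ _+_ (#ω<-through d (suc s) r (pred b) d+s+1≡k d≤r) (#ω<-through d (suc s) r b d+s+1≡k d≤r) ⟩
    2 * smallSubsets r (pred b) + 2 * smallSubsets r b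
      ≡⟨ *-distribˡ-+ 2 (smallSubsets r (pred b)) (smallSubsets r b) ⟨
    2 * smallSubsets (suc r) b
      ∎
    where
      open ≡-Reasoning
      s≢k : s ≢ k
      s≢k s≡k = m≢1+n+m s (trans s≡k (sym d+1+s≡k))
      d+s+1≡k : d + suc s ≡ k
      d+s+1≡k = trans (+-suc d s) d+1+s≡k

  #𝒜-above : ∀ s r → k < suc s → #𝒜 (suc s) r ≡ schreier r s
  #𝒜-above s zero    _     = refl
  #𝒜-above s (suc r) k<1+s = begin
    #𝒜 (suc s) (suc r)                    ≡⟨ #𝒜-suc-≢ (suc s) r (>⇒≢ k<1+s) ⟩
    #ω< (2 + s) r s + #𝒜 (2 + s) r        ≡⟨ cong₂ _+_ (#ω<-above (2 + s) r s k<2+s) (#𝒜-above (suc s) r k<2+s) ⟩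
    smallSubsets r s + schreier r (suc s) ∎
    where
      open ≡-Reasoning
      k<2+s = m<n⇒m<1+n k<1+s

  #𝒜-through : ∀ d s ℓ → d + suc s ≡ k → ℓ < k → #𝒜 (suc s) (suc (d + ℓ)) ≡ 2 * schreier (d + ℓ) s
  #𝒜-through zero s ℓ s+1≡k ℓ<k = begin
    #𝒜 (suc s) (suc ℓ)                          ≡⟨ #𝒜-suc-≡ (suc s) ℓ s+1≡k ⟩
    #ω< (2 + s) ℓ (suc s) + #𝒜 (2 + s) ℓ        ≡⟨ cong₂ _+_ (#ω<-above (2 + s) ℓ (suc s) k<2+s)
                                                             (#𝒜-above (suc s) ℓ k<2+s) ⟩
    smallSubsets ℓ (suc s) + schreier ℓ (suc s) ≡⟨ cong₂ _+_ (smallSubsets-all ℓ (suc s) ℓ<1+s)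
                                                             (schreier-all ℓ (suc s) (<⇒≤ ℓ<1+s)) ⟩
    2 ^ ℓ + 2 ^ ℓ                               ≡⟨ m+m≡2*m (2 ^ ℓ) ⟩
    2 * 2 ^ ℓ                                   ≡⟨ cong (2 *_) (schreier-all ℓ s (m<1+n⇒m≤n ℓ<1+s)) ⟨
    2 * schreier ℓ s                            ∎
    where
      open ≡-Reasoning
      k<2+s : k < 2 + s
      k<2+s = s≤s (≤-reflexive (sym s+1≡k))
      ℓ<1+s : ℓ < suc s
      ℓ<1+s = subst (ℓ <_) (sym s+1≡k) ℓ<k
  #𝒜-through (suc d) s ℓ d+1+s+1≡k ℓ<k = begin
    #𝒜 (suc s) (2 + (d + ℓ))
      ≡⟨ #𝒜-suc-≢ (suc s) (suc (d + ℓ)) s+1≢k ⟩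
    #ω< (2 + s) (suc (d + ℓ)) s + #𝒜 (2 + s) (suc (d + ℓ))
      ≡⟨ cong₂ _+_ (#ω<-through d (2 + s) (d + ℓ) s d+s+2≡k (m≤m+n d ℓ)) (#𝒜-through d (suc s) ℓ d+s+2≡k ℓ<k) ⟩
    2 * smallSubsets (d + ℓ) s + 2 * schreier (d + ℓ) (suc s)
      ≡⟨ *-distribˡ-+ 2 (smallSubsets (d + ℓ) s) (schreier (d + ℓ) (suc s)) ⟨
    2 * schreier (suc (d + ℓ)) s
      ∎
    where
      open ≡-Reasoning
      s+1≢k : suc s ≢ k
      s+1≢k s+1≡k = m≢1+n+m (suc s) (trans s+1≡k (sym d+1+s+1≡k))
      d+s+2≡k : d + (2 + s) ≡ k
      d+s+2≡k = trans (+-suc d (suc s)) d+1+s+1≡k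

a-closed-form : ∀ ℓ k → ℓ < k → a k (k + ℓ) ≡ 2 * F (k + ℓ)
a-closed-form ℓ (suc d) ℓ<k = begin
  a (suc d) (suc d + ℓ)        ≡⟨⟩
  #𝒜 (suc d) 1 (suc (d + ℓ))   ≡⟨ #𝒜-through (suc d) d 0 ℓ (+-comm d 1) ℓ<k ⟩
  2 * schreier (d + ℓ) 0       ≡⟨ cong (2 *_) (schreier-fib (d + ℓ)) ⟩
  2 * F (suc (d + ℓ))          ∎
  where open ≡-Reasoning

theorem1p4 : (ℓ k : ℕ) → ℓ + 2 ≤ k → a k (k + ℓ) ≡ 2 * F (k + ℓ)
theorem1p4 ℓ k ℓ+2≤k = a-closed-form ℓ k (<-≤-trans (m<m+n ℓ z<s) ℓ+2≤k)
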